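{- Let $G$ be a twin-free simple graph on the vertex set $\{v_1,\dots,v_n\}$, and suppose that for some $1\le m\le n$ the set $M=\{v_1,v_2,\dots,v_m\}$ is an identifying code of $G$. Then the lexicographic algorithm (described in the context) run on $G$ returns a set $C$ of indices such that $\{v_c: c\in C\}$ is an identifying code of $G$ contained in $M$.
   Context: For a vertex $v$, $N(v)=\{v\}\cup\{w: vw\in E(G)\}$ is its closed neighbourhood. A set $C$ of vertices is an identifying code if $N(v)\cap C\neq\emptyset$ for every vertex $v$ and $N(v)\cap C\neq N(w)\cap C$ for all distinct vertices $v,w$. $G$ is twin-free if there are no two distinct vertices $v,w$ with $N(v)=N(w)$. Vertices are identified with their indices. Let ${\bf B}={\bf I}_n+{\bf A}$ (${\bf A}$ the adjacency matrix), so ${\bf B}(i,l)=1$ iff $v_i\in N(v_l)$. Let $\mathtt{min1}(j)$ be the smallest index $i$ with $v_i\in N(v_j)$. Let $\mathtt{min2}(j,k)$ be the smallest $l\in\{1,\dots,n\}$ with ${\bf B}(j,l)\neq{\bf B}(k,l)$, or $n+1$ if no such $l$ exists. The lexicographic algorithm: initialise $C\gets\emptyset$, ${\bf X}\gets$ the $n\times n$ zero matrix, $j\gets 1$. While $j\le n$ and $n+1\notin C$: set $l\gets 0$; if row $j$ of ${\bf X}$ is zero, set $l\gets\mathtt{min1}(j)$; otherwise set $k\gets 1$ and, while row $j$ of ${\bf X}$ differs from row $k$ of ${\bf X}$ and $k<j$, increment $k$; then if $k<j$, set $l\gets\mathtt{min2}(j,k)$. If $l\ge 1$, add $l$ to $C$,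 and if moreover $l\le n$, replace column $l$ of ${\bf X}$ by column $l$ of ${\bf B}$. Then increment $j$. Finally return $C$. -}

module Defs where

open import Data.Nat using (ℕ; zero; suc; _+_; _∸_; _<_; _≤_; _≡ᵇ_; _≤ᵇ_; _<ᵇ_)
open import Data.Nat.Properties using (_<?_)
open import Data.Bool using (Bool; true; false; _∧_; _∨_; not; if_then_else_)
open import Data.Fin using (Fin; fromℕ<)
open import Data.List using (List; []; _∷_; _++_; upTo; map)
open import Data.Bool.ListAction using (all; any)
open import Data.Maybe using (Maybe; just; nothing)
open import Data.Product using (_×_; ∃)
open import Data.Sum using (_⊎_)
open import Relation.Binary.PropositionalEquality using (_≡_; _≢_)
open import Relation.Nullary using (¬_; yes; no)
open import Function using (_⇔_)

-- A finite simple graph on the vertex set Fin n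
-- (vertex v_i of the paper is the element of Fin n with toℕ = i - 1).
record Graph (n : ℕ) : Set where
  field
    adj    : Fin n → Fin n → Bool
    sym    : ∀ u v → adj u v ≡ adj v u
    irrefl : ∀ u → adj u u ≡ false
open Graph public

InN : ∀ {n} → Graph n → Fin n → Fin n → Set
InN G v u = u ≡ v ⊎ adj G v u ≡ true

TwinFree : ∀ {n} → Graph n → Set
TwinFree {n} G = ∀ v w → (∀ u → InN G v u ⇔ InN G w u) → v ≡ w

IsIdCode : ∀ {n} → Graph n → (Fin n → Set) → Set
IsIdCode {n} G S =
  (∀ v → ∃ λ u → InN G v u × S u) ×
  (∀ v w → v ≢ w → ¬ (∀ u → (InN G v u × S u) ⇔ (InN G w u × S u)))

-- The lexicographic algorithm, with 1-based natural-number indices.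

vtx : (n i : ℕ) → Maybe (Fin n)
vtx n zero = nothing
vtx n (suc i) with i <? n
... | yes p = just (fromℕ< p)
... | no _  = nothing

-- B = I + A; B(i,l) = 1 iff v_i ∈ N(v_l); 0 outside 1..n
Bm : ∀ {n} → Graph n → ℕ → ℕ → Bool
Bm {n} G i l with vtx n i | vtx n l
... | just a | just b = (i ≡ᵇ l) ∨ adj G b a
... | _      | _      = false

range : ℕ → List ℕ
range n = map suc (upTo n)

firstWith : (ℕ → Bool) → ℕ → List ℕ → ℕ
firstWith p d [] = d
firstWith p d (x ∷ xs) = if p x then x else firstWith p d xs

min1 : ∀ {n} → Graph n → ℕ → ℕ
min1 {n} G j = firstWith (λ i → Bm G i j) (suc n) (range n)

min2 : ∀ {n} → Graph n → ℕ → ℕ → ℕ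
min2 {n} G j k = firstWith (λ l → not (Bm G j l ≡ᵇB Bm G k l)) (suc n) (range n)
  where
  _≡ᵇB_ : Bool → Bool → Bool
  true  ≡ᵇB b = b
  false ≡ᵇB b = not b

Mat : Set
Mat = ℕ → ℕ → Bool

memb : ℕ → List ℕ → Bool
memb x xs = any (λ y → x ≡ᵇ y) xs

rowZero : ℕ → Mat → ℕ → Bool
rowZero n X j = all (λ l → not (X j l)) (range n)

rowsDiffer : ℕ → Mat → ℕ → ℕ → Bool
rowsDiffer n X j k = any (λ l → not (eqB (X j l) (X k l))) (range n)
  where
  eqB : Bool → Bool → Bool
  eqB true b = b
  eqB false b = not b

-- inner loop: while row j ≠ row k and k < j, increment k (fuel bounds it)
findK : ℕ → Mat → ℕ → ℕ → ℕ → ℕ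
findK n X j zero k = k
findK n X j (suc f) k =
  if rowsDiffer n X j k ∧ (k <ᵇ j) then findK n X j f (suc k) else k

setCol : ∀ {n} → Graph n → Mat → ℕ → Mat
setCol G X l i l' = if l' ≡ᵇ l then Bm G i l' else X i l'

lexLoop : ∀ {n} → Graph n → ℕ → ℕ → List ℕ → Mat → List ℕ
lexLoop {n} G zero j C X = C
lexLoop {n} G (suc f) j C X =
  if (j ≤ᵇ n) ∧ not (memb (suc n) C) then body else C
  where
  k : ℕ
  k = findK n X j j 1
  l : ℕ
  l = if rowZero n X j then min1 G j
      else (if k <ᵇ j then min2 G j k else 0)
  body : List ℕ
  body = if 1 ≤ᵇ l
         then lexLoop G f (suc j) (C ++ (l ∷ [])) (if l ≤ᵇ n then setCol G X l else X)
         else lexLoop G f (suc j) C X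

lexAlg : ∀ {n} → Graph n → List ℕ
lexAlg {n} G = lexLoop G n 1 [] (λ _ _ → false)

module Submission where

-- The algorithm works on the matrix B = I + A.  After processing
-- rows 1..j-1, the column list C "identifies" these rows: they are all
-- dominated and pairwise separated by C.  The working matrix X is B with the
-- columns outside C zeroed, so the tests of the algorithm on X (zero row,
-- equal rows) are tests about C.  When row j is undominated the column
-- min1(j) is added, when it agrees on C with an earlier row k the column
-- min2(j,k) is added, and otherwise nothing is needed.  Because M = {1..m} is
-- an identifying code, min1 and min2 find suitable columns inside M, so every
-- added column lies in 1..m.

open import Defs
open import Data.Nat using (ℕ; suc; _≤_; _<_)
open import Data.Fin using (toℕ)
open import Data.List.Membership.Propositional using (_∈_)
open import Data.Product using (_×_)

open import Data.Nat using (zero; _+_; _≡ᵇ_; _≤ᵇ_; _<ᵇ_; z≤n; s≤s)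
import Data.Nat.Properties as ℕ
open import Data.Fin using (Fin; fromℕ<)
open import Data.Fin.Properties using (fromℕ<-toℕ; toℕ<n; toℕ-fromℕ<; toℕ-injective)
open import Data.Bool using (Bool; true; false; _∨_; _∧_; not; if_then_else_; T)
open import Data.Bool.Properties using (T-≡; T-∨; T?) renaming (_≟_ to _≟ᵇ_)
open import Data.List using (List; []; _∷_; _++_; [_]; map; upTo)
open import Data.List.Properties using (upTo-∷ʳ; map-++; ++-identityʳ; ++-assoc)
open import Data.List.Membership.Propositional using (_∉_; find; lose)
open import Data.List.Membership.Propositional.Properties
  using (∈-map⁺; ∈-map⁻; ∈-++⁺ˡ; ∈-++⁺ʳ; ∈-++⁻; ∈-upTo⁺; ∈-upTo⁻)
open import Data.List.Membership.DecPropositional ℕ._≟_ using (_∈?_)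
open import Data.List.Relation.Binary.Subset.Propositional using (_⊆_)
open import Data.List.Relation.Binary.Subset.Propositional.Properties using (xs⊆xs++ys)
open import Data.List.Relation.Unary.Any using (here; there; any?)
open import Data.List.Relation.Unary.Any.Properties using (any⁺; any⁻)
open import Data.List.Relation.Unary.All using (lookup)
open import Data.List.Relation.Unary.All.Properties using (all⁺; all⁻; ¬All⇒Any¬)
open import Data.Product using (Σ; ∃; _,_; proj₁; proj₂; map₂)
open import Data.Sum using (_⊎_; inj₁; inj₂)
open import Data.Empty using (⊥-elim)
open import Data.Maybe using (just; nothing)
open import Relation.Nullary using (¬_; yes; no)
open import Relation.Nullary.Decidable using (¬?; decidable-stable)
open import Relation.Binary using (tri<; tri≈; tri>)
open import Relation.Binary.PropositionalEquality as ≡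
  using (_≡_; _≢_; refl; trans; cong; cong₂; subst; module ≡-Reasoning)
open import Function using (_⇔_; mk⇔; _∘_)
open import Function.Bundles using (module Equivalence)
open Equivalence using (to; from)

if-true : ∀ {A : Set} {b : Bool} {x y : A} → b ≡ true → (if b then x else y) ≡ x
if-true refl = refl

clash : ∀ {A : Set} {b : Bool} → b ≡ false → b ≡ true → A
clash refl ()

bool-ext : ∀ {a b : Bool} → (a ≡ true → b ≡ true) → (b ≡ true → a ≡ true) → a ≡ b
bool-ext {true}  {true}  _ _ = refl
bool-ext {false} {false} _ _ = refl
bool-ext {true}  {false} a⇒b _ = ≡.sym (a⇒b refl)
bool-ext {false} {true}  _ b⇒a = b⇒a refl

T-not : ∀ {b} → T (not b) → b ≡ false
T-not {false} _ = refl

¬T-not : ∀ {b} → ¬ T (not b) → b ≡ true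
¬T-not {true}  _  = refl
¬T-not {false} nt = ⊥-elim (nt _)

≡ᵇ-true : ∀ {a b} → (a ≡ᵇ b) ≡ true → a ≡ b
≡ᵇ-true {a} {b} e = ℕ.≡ᵇ⇒≡ a b (from T-≡ e)

≡ᵇ-refl : ∀ a → (a ≡ᵇ a) ≡ true
≡ᵇ-refl a = to T-≡ (ℕ.≡⇒≡ᵇ a a refl)

≡ᵇ-sym : ∀ a b → (a ≡ᵇ b) ≡ (b ≡ᵇ a)
≡ᵇ-sym zero    zero    = refl
≡ᵇ-sym zero    (suc b) = refl
≡ᵇ-sym (suc a) zero    = refl
≡ᵇ-sym (suc a) (suc b) = ≡ᵇ-sym a b

<ᵇ-true : ∀ {a b} → (a <ᵇ b) ≡ true → a < b
<ᵇ-true {a} {b} e = ℕ.<ᵇ⇒< a b (from T-≡ e)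

<ᵇ-false : ∀ {a b} → (a <ᵇ b) ≡ false → b ≤ a
<ᵇ-false e = ℕ.≮⇒≥ λ a<b → clash e (to T-≡ (ℕ.<⇒<ᵇ a<b))

≤ᵇ-complete : ∀ {a b} → a ≤ b → (a ≤ᵇ b) ≡ true
≤ᵇ-complete a≤b = to T-≡ (ℕ.≤⇒≤ᵇ a≤b)

range-suc : ∀ n → range (suc n) ≡ range n ++ [ suc n ]
range-suc n = begin
  map suc (upTo (suc n))          ≡⟨ cong (map suc) (≡.sym (upTo-∷ʳ n)) ⟩
  map suc (upTo n ++ [ n ])       ≡⟨ map-++ suc (upTo n) [ n ] ⟩
  range n ++ [ suc n ]            ∎
  where open ≡-Reasoning

range-prefix : ∀ {m n} → m ≤ n → ∃ λ ys → range n ≡ range m ++ ys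
range-prefix {m} {zero} z≤n = [] , refl
range-prefix {m} {suc n} m≤1+n with ℕ.m≤n⇒m<n∨m≡n m≤1+n
... | inj₂ refl = [] , ≡.sym (++-identityʳ (range (suc n)))
... | inj₁ (s≤s m≤n) with range-prefix m≤n
... | ys , eq = ys ++ [ suc n ] , (begin
  range (suc n)                   ≡⟨ range-suc n ⟩
  range n ++ [ suc n ]            ≡⟨ cong (_++ [ suc n ]) eq ⟩
  (range m ++ ys) ++ [ suc n ]    ≡⟨ ++-assoc (range m) ys [ suc n ] ⟩
  range m ++ ys ++ [ suc n ]      ∎)
  where open ≡-Reasoning

range-bounds : ∀ {x m} → x ∈ range m → 1 ≤ x × x ≤ m
range-bounds x∈ with ∈-map⁻ suc x∈
... | y , y∈ , refl = s≤s z≤n , ∈-upTo⁻ y∈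

∈-range : ∀ {x m} → 1 ≤ x → x ≤ m → x ∈ range m
∈-range {suc y} (s≤s z≤n) y<m = ∈-map⁺ suc (∈-upTo⁺ y<m)

firstWith-prefix : ∀ (p : ℕ → Bool) d xs ys →
  (∀ x → x ∈ xs → p x ≡ false) ⊎
  (firstWith p d (xs ++ ys) ∈ xs × p (firstWith p d (xs ++ ys)) ≡ true)
firstWith-prefix p d [] ys = inj₁ (λ _ ())
firstWith-prefix p d (x ∷ xs) ys with p x in px | firstWith-prefix p d xs ys
... | true  | _ = inj₂ (here refl , px)
... | false | inj₁ none = inj₁ λ { y (here refl) → px ; y (there y∈) → none y y∈ }
... | false | inj₂ (r∈ , hit) = inj₂ (there r∈ , hit)

-- The same for a search through 1..n, with prefix 1..m.  The result r is
-- named separately so that the search predicate can be found by unification.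
firstWith-range : ∀ {p : ℕ → Bool} {d m n} r → r ≡ firstWith p d (range n) → m ≤ n →
  (∀ x → x ∈ range m → p x ≡ false) ⊎ (r ∈ range m × p r ≡ true)
firstWith-range {p} {d} {m} r refl m≤n with range-prefix m≤n
... | ys , eq rewrite eq = firstWith-prefix p d (range m) ys

Bounded : ℕ → List ℕ → Set
Bounded m C = ∀ c → c ∈ C → 1 ≤ c × c ≤ m

memb-absent : ∀ {x C} → (∀ c → c ∈ C → c < x) → memb x C ≡ false
memb-absent {x} {C} below with memb x C in e
... | false = refl
... | true with find (any⁻ (λ y → x ≡ᵇ y) C (from T-≡ e))
... | y , y∈ , x≡y = ⊥-elim (ℕ.<-irrefl (≡.sym (ℕ.≡ᵇ⇒≡ x y x≡y)) (below y y∈))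

idx : ∀ {n} → Fin n → ℕ
idx v = suc (toℕ v)

vtx-idx : ∀ {n} (v : Fin n) → vtx n (idx v) ≡ just v
vtx-idx {n} v with toℕ v ℕ.<? n
... | yes p = cong just (fromℕ<-toℕ v p)
... | no ¬p = ⊥-elim (¬p (toℕ<n v))

idx-onto : ∀ {n} i → 1 ≤ i → i ≤ n → Σ (Fin n) λ v → idx v ≡ i
idx-onto (suc i) (s≤s z≤n) i<n = fromℕ< i<n , cong suc (toℕ-fromℕ< i<n)

module _ {n : ℕ} (G : Graph n) where

  Bm-idx : ∀ (v u : Fin n) → Bm G (idx v) (idx u) ≡ ((toℕ v ≡ᵇ toℕ u) ∨ adj G u v)
  Bm-idx v u rewrite vtx-idx v | vtx-idx u = refl

  Bm-sym : ∀ i l → Bm G i l ≡ Bm G l i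
  Bm-sym i l with vtx n i | vtx n l
  ... | just a  | just b  = cong₂ _∨_ (≡ᵇ-sym i l) (Graph.sym G b a)
  ... | just _  | nothing = refl
  ... | nothing | just _  = refl
  ... | nothing | nothing = refl

  B⇔InN : ∀ (v u : Fin n) → Bm G (idx v) (idx u) ≡ true ⇔ InN G v u
  B⇔InN v u = mk⇔ B→InN InN→B
    where
    B→InN : Bm G (idx v) (idx u) ≡ true → InN G v u
    B→InN b with to T-∨ (subst T (Bm-idx v u) (from T-≡ b))
    ... | inj₁ same = inj₁ (≡.sym (toℕ-injective (ℕ.≡ᵇ⇒≡ (toℕ v) (toℕ u) same)))
    ... | inj₂ uv  = inj₂ (trans (Graph.sym G v u) (to T-≡ uv))
    entry : InN G v u → T (toℕ v ≡ᵇ toℕ u) ⊎ T (adj G u v)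
    entry (inj₁ refl) = inj₁ (ℕ.≡⇒≡ᵇ (toℕ u) (toℕ u) refl)
    entry (inj₂ vu)   = inj₂ (from T-≡ (trans (Graph.sym G u v) vu))
    InN→B : InN G v u → Bm G (idx v) (idx u) ≡ true
    InN→B = to T-≡ ∘ subst T (≡.sym (Bm-idx v u)) ∘ from T-∨ ∘ entry

  Dom : List ℕ → ℕ → Set
  Dom C i = ∃ λ l → l ∈ C × Bm G i l ≡ true

  Sep : List ℕ → ℕ → ℕ → Set
  Sep C i i' = ∃ λ l → l ∈ C × Bm G i l ≢ Bm G i' l

  record Identifies (j : ℕ) (C : List ℕ) : Set where
    field
      dominated : ∀ i → 1 ≤ i → i < j → Dom C i
      separated : ∀ i i' → 1 ≤ i' → i' < i → i < j → Sep C i i'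
  open Identifies public

  sep-sym : ∀ {C} i i' → Sep C i i' → Sep C i' i
  sep-sym i i' (l , l∈ , ne) = l , l∈ , ne ∘ ≡.sym

  identifies-⊆ : ∀ {j C D} → C ⊆ D → Identifies j C → Identifies j D
  identifies-⊆ C⊆D ids = record
    { dominated = λ i a b → let (l , l∈ , t) = dominated ids i a b in l , C⊆D l∈ , t
    ; separated = λ i i' a b c → let (l , l∈ , ne) = separated ids i i' a b c in l , C⊆D l∈ , ne
    }

  -- Separation is symmetric, so identified rows are separated in either order.
  separates : ∀ {C j k} → Identifies (suc n) C →
    1 ≤ j → j ≤ n → 1 ≤ k → k ≤ n → j ≢ k → Sep C j k
  separates {j = j} {k} ids 1≤j j≤n 1≤k k≤n j≢k with ℕ.<-cmp j k
  ... | tri< j<k _ _ = sep-sym k j (separated ids k j 1≤j j<k (s≤s k≤n))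
  ... | tri≈ _ j≡k _ = ⊥-elim (j≢k j≡k)
  ... | tri> _ _ k<j = separated ids j k 1≤k k<j (s≤s j≤n)

  sameTrace : ∀ {S : Fin n → Set} v w →
    (∀ u → S u → Bm G (idx v) (idx u) ≡ Bm G (idx w) (idx u)) →
    ∀ u → (InN G v u × S u) ⇔ (InN G w u × S u)
  sameTrace v w agree u = mk⇔
    (λ (inN , s) → to (B⇔InN w u) (trans (≡.sym (agree u s)) (from (B⇔InN v u) inN)) , s)
    (λ (inN , s) → to (B⇔InN v u) (trans (agree u s) (from (B⇔InN w u) inN)) , s)

  traceAgree : ∀ {S : Fin n → Set} v w →
    (∀ u → (InN G v u × S u) ⇔ (InN G w u × S u)) →
    ∀ u → S u → Bm G (idx v) (idx u) ≡ Bm G (idx w) (idx u)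
  traceAgree v w same u s = bool-ext
    (λ bv → from (B⇔InN w u) (proj₁ (to (same u) (to (B⇔InN v u) bv , s))))
    (λ bw → from (B⇔InN v u) (proj₁ (from (same u) (to (B⇔InN w u) bw , s))))

  identifies-from-code : ∀ {S : Fin n → Set} {C} → (∀ u → S u → idx u ∈ C) →
    IsIdCode G S → Identifies (suc n) C
  identifies-from-code {S} {C} S⊆C (codeDom , codeSep) = record
    { dominated = dominatedRow ; separated = separatedRows }
    where
    dominatedRow : ∀ i → 1 ≤ i → i < suc n → Dom C i
    dominatedRow i 1≤i (s≤s i≤n) with idx-onto i 1≤i i≤n
    ... | v , refl with codeDom v
    ... | u , inN , s = idx u , S⊆C u s , from (B⇔InN v u) inN
    separatedRows : ∀ i i' → 1 ≤ i' → i' < i → i < suc n → Sep C i i'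
    separatedRows i i' 1≤i' i'<i (s≤s i≤n)
      with idx-onto i (ℕ.≤-trans 1≤i' (ℕ.<⇒≤ i'<i)) i≤n
         | idx-onto i' 1≤i' (ℕ.<⇒≤ (ℕ.<-≤-trans i'<i i≤n))
    ... | v , refl | w , refl with any? (λ l → ¬? (Bm G (idx v) l ≟ᵇ Bm G (idx w) l)) C
    ... | yes differs = find differs
    ... | no ¬differs = ⊥-elim (codeSep v w (λ v≡w → ℕ.<-irrefl (cong idx (≡.sym v≡w)) i'<i)
            (sameTrace v w λ u s → decidable-stable (Bm G (idx v) (idx u) ≟ᵇ Bm G (idx w) (idx u))
              (λ ne → ¬differs (lose (S⊆C u s) ne))))

  code-from-identifies : ∀ {C} → Bounded n C → Identifies (suc n) C →
    IsIdCode G (λ u → idx u ∈ C)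
  code-from-identifies {C} bounded ids = dominatedVertex , separatedVertices
    where
    codeVertex : ∀ {l} → l ∈ C → Σ (Fin n) λ u → idx u ≡ l
    codeVertex l∈ = idx-onto _ (proj₁ (bounded _ l∈)) (proj₂ (bounded _ l∈))
    dominatedVertex : ∀ v → ∃ λ u → InN G v u × idx u ∈ C
    dominatedVertex v with dominated ids (idx v) (s≤s z≤n) (s≤s (toℕ<n v))
    ... | l , l∈ , b with codeVertex l∈
    ... | u , refl = u , to (B⇔InN v u) b , l∈
    separatedVertices : ∀ v w → v ≢ w →
      ¬ (∀ u → (InN G v u × idx u ∈ C) ⇔ (InN G w u × idx u ∈ C))
    separatedVertices v w v≢w same
      with separates ids (s≤s z≤n) (toℕ<n v) (s≤s z≤n) (toℕ<n w)
             (v≢w ∘ toℕ-injective ∘ ℕ.suc-injective)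
    ... | l , l∈ , ne with codeVertex l∈
    ... | u , refl = ne (traceAgree v w same u l∈)

  zero-row : ∀ {X j} → rowZero n X j ≡ true → ∀ l → l ∈ range n → X j l ≡ false
  zero-row {X} {j} z l l∈ = T-not (lookup (all⁺ (λ l → not (X j l)) (range n) (from T-≡ z)) l∈)

  nonzero-row : ∀ {X j} → rowZero n X j ≡ false → ∃ λ l → l ∈ range n × X j l ≡ true
  nonzero-row {X} {j} nz with find (¬All⇒Any¬ (T? ∘ p) (range n) (λ all → subst T nz (all⁻ p all)))
    where p = λ l → not (X j l)
  ... | l , l∈ , ¬t = l , l∈ , ¬T-not ¬t

  -- rowsDiffer compares entries with a local equality test, so the entries
  -- are inspected by cases.
  differing-rows : ∀ {X j k} → rowsDiffer n X j k ≡ true → ∃ λ l → X j l ≢ X k l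
  differing-rows {X} {j} {k} d with find (any⁻ _ (range n) (from T-≡ d))
  ... | l , _ , t with X j l in xj | X k l in xk | t
  ... | true  | false | _ = l , λ e → clash xk (trans (≡.sym e) xj)
  ... | false | true  | _ = l , λ e → clash xj (trans e xk)
  ... | true  | true  | ()
  ... | false | false | ()

  agreeing-rows : ∀ {X j k} → rowsDiffer n X j k ≡ false → ∀ l → l ∈ range n → X j l ≡ X k l
  agreeing-rows {X} {j} {k} a l l∈ with X j l | X k l | (λ t → subst T a (any⁺ _ (lose l∈ t)))
  ... | true  | true  | _  = refl
  ... | false | false | _  = refl
  ... | true  | false | ¬t = ⊥-elim (¬t _)
  ... | false | true  | ¬t = ⊥-elim (¬t _)

  module Algorithm (m : ℕ) (m≤n : m ≤ n) (M-ids : Identifies (suc n) (range m)) where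

    min1-in-M : ∀ {j} → 1 ≤ j → j ≤ n → min1 G j ∈ range m × Bm G j (min1 G j) ≡ true
    min1-in-M {j} 1≤j j≤n with dominated M-ids j 1≤j (s≤s j≤n) | firstWith-range (min1 G j) refl m≤n
    ... | x , x∈ , bx | inj₁ none = clash (none x x∈) (trans (Bm-sym x j) bx)
    ... | _ | inj₂ (r∈ , hit) = r∈ , trans (Bm-sym j (min1 G j)) hit

    -- min2(j,k) is a column of M separating rows j and k.  The search uses a
    -- local equality test on entries, so the entries are inspected by cases.
    min2-in-M : ∀ {j k} → 1 ≤ j → j ≤ n → 1 ≤ k → k ≤ n → j ≢ k →
      min2 G j k ∈ range m × Bm G j (min2 G j k) ≢ Bm G k (min2 G j k)
    min2-in-M {j} {k} 1≤j j≤n 1≤k k≤n j≢k with firstWith-range (min2 G j k) refl m≤n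
    ... | inj₂ (r∈ , hit) with Bm G j (min2 G j k) | Bm G k (min2 G j k) | hit
    ...   | true  | false | _ = r∈ , λ ()
    ...   | false | true  | _ = r∈ , λ ()
    ...   | true  | true  | ()
    ...   | false | false | ()
    min2-in-M {j} {k} 1≤j j≤n 1≤k k≤n j≢k | inj₁ none
      with separates M-ids 1≤j j≤n 1≤k k≤n j≢k
    ... | x , x∈ , ne with Bm G j x | Bm G k x | none x x∈ | ne
    ...   | true  | true  | _  | ne' = ⊥-elim (ne' refl)
    ...   | false | false | _  | ne' = ⊥-elim (ne' refl)
    ...   | true  | false | () | _
    ...   | false | true  | () | _

    record Invariant (C : List ℕ) (X : Mat) : Set where
      field
        bounded : Bounded m C
        onCode  : ∀ i l → l ∈ C → X i l ≡ Bm G i l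
        offCode : ∀ i l → l ∉ C → X i l ≡ false
    open Invariant

    invariant-init : Invariant [] (λ _ _ → false)
    invariant-init = record { bounded = λ _ () ; onCode = λ _ _ () ; offCode = λ _ _ _ → refl }

    invariant-add : ∀ {C X l} → Invariant C X → 1 ≤ l → l ≤ m →
      Invariant (C ++ [ l ]) (setCol G X l)
    invariant-add {C} {X} {l} inv 1≤l l≤m = record
      { bounded = bounded′ ; onCode = onCode′ ; offCode = offCode′ }
      where
      bounded′ : Bounded m (C ++ [ l ])
      bounded′ c c∈ with ∈-++⁻ C c∈
      ... | inj₁ c∈C = bounded inv c c∈C
      ... | inj₂ (here refl) = 1≤l , l≤m
      onCode′ : ∀ i l' → l' ∈ C ++ [ l ] → setCol G X l i l' ≡ Bm G i l'
      onCode′ i l' l'∈ with l' ≡ᵇ l in e | ∈-++⁻ C l'∈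
      ... | true  | _ = refl
      ... | false | inj₁ l'∈C = onCode inv i l' l'∈C
      ... | false | inj₂ (here refl) = clash e (≡ᵇ-refl l)
      offCode′ : ∀ i l' → l' ∉ C ++ [ l ] → setCol G X l i l' ≡ false
      offCode′ i l' l'∉ with l' ≡ᵇ l in e
      ... | true  = ⊥-elim (l'∉ (∈-++⁺ʳ C (here (≡ᵇ-true e))))
      ... | false = offCode inv i l' (l'∉ ∘ ∈-++⁺ˡ)

    code⊆range : ∀ {C X} → Invariant C X → ∀ {l} → l ∈ C → l ∈ range n
    code⊆range inv l∈ =
      ∈-range (proj₁ (bounded inv _ l∈)) (ℕ.≤-trans (proj₂ (bounded inv _ l∈)) m≤n)

    undominated : ∀ {C X j} → Invariant C X → rowZero n X j ≡ true →
      ∀ l → l ∈ C → Bm G j l ≡ false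
    undominated {X = X} {j} inv z l l∈ =
      trans (≡.sym (onCode inv j l l∈)) (zero-row {X} {j} z l (code⊆range inv l∈))

    dominated-row : ∀ {C X j} → Invariant C X → rowZero n X j ≡ false → Dom C j
    dominated-row {C} {X} {j} inv nz with nonzero-row {X} {j} nz
    ... | l , _ , xl with l ∈? C
    ... | yes l∈ = l , l∈ , trans (≡.sym (onCode inv j l l∈)) xl
    ... | no l∉  = clash (offCode inv j l l∉) xl

    separated-rows : ∀ {C X j k} → Invariant C X → rowsDiffer n X j k ≡ true → Sep C j k
    separated-rows {C} {X} {j} {k} inv d with differing-rows {X} {j} {k} d
    ... | l , ne with l ∈? C
    ... | yes l∈ = l , l∈ , λ e → ne (trans (onCode inv j l l∈) (trans e (≡.sym (onCode inv k l l∈))))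
    ... | no l∉  = ⊥-elim (ne (trans (offCode inv j l l∉) (≡.sym (offCode inv k l l∉))))

    twin-rows : ∀ {C X j k} → Invariant C X → rowsDiffer n X j k ≡ false →
      ∀ l → l ∈ C → Bm G j l ≡ Bm G k l
    twin-rows {X = X} {j} {k} inv a l l∈ = begin
      Bm G j l  ≡⟨ ≡.sym (onCode inv j l l∈) ⟩
      X j l     ≡⟨ agreeing-rows {X} {j} {k} a l (code⊆range inv l∈) ⟩
      X k l     ≡⟨ onCode inv k l l∈ ⟩
      Bm G k l  ∎
      where open ≡-Reasoning

    -- findK X j f k0 is the first k ≥ k0 whose row of X equals row j,
    -- where k = j means that no earlier row does.
    record FirstTwin (X : Mat) (j k0 k : ℕ) : Set where
      field
        start   : k0 ≤ k
        stop    : k ≤ j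
        earlier : ∀ k' → k0 ≤ k' → k' < k → rowsDiffer n X j k' ≡ true
        twin    : k < j → rowsDiffer n X j k ≡ false
    open FirstTwin

    firstTwin-here : ∀ {X j k0} → k0 ≤ j → (k0 < j → rowsDiffer n X j k0 ≡ false) →
      FirstTwin X j k0 k0
    firstTwin-here k0≤j tw = record
      { start = ℕ.≤-refl ; stop = k0≤j ; twin = tw
      ; earlier = λ k' k0≤k' k'<k0 → ⊥-elim (ℕ.<-irrefl refl (ℕ.<-≤-trans k'<k0 k0≤k')) }

    findK-spec : ∀ X j f k0 → k0 ≤ j → j ≤ k0 + f → FirstTwin X j k0 (findK n X j f k0)
    findK-spec X j zero k0 k0≤j j≤k0 =
      firstTwin-here k0≤j λ k0<j → ⊥-elim (ℕ.<⇒≱ k0<j (subst (j ≤_) (ℕ.+-identityʳ k0) j≤k0))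
    findK-spec X j (suc f) k0 k0≤j j≤k0+f with rowsDiffer n X j k0 in d | k0 <ᵇ j in lt
    ... | false | _     = firstTwin-here k0≤j λ _ → d
    ... | true  | false = firstTwin-here k0≤j λ k0<j → ⊥-elim (ℕ.<⇒≱ k0<j (<ᵇ-false lt))
    ... | true  | true  = record
      { start = ℕ.≤-trans (ℕ.n≤1+n k0) (start rest) ; stop = stop rest ; twin = twin rest
      ; earlier = earlier′ }
      where
      rest : FirstTwin X j (suc k0) (findK n X j f (suc k0))
      rest = findK-spec X j f (suc k0) (<ᵇ-true lt) (subst (j ≤_) (ℕ.+-suc k0 f) j≤k0+f)
      earlier′ : ∀ k' → k0 ≤ k' → k' < findK n X j f (suc k0) → rowsDiffer n X j k' ≡ true
      earlier′ k' k0≤k' k'<k with ℕ.m≤n⇒m<n∨m≡n k0≤k'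
      ... | inj₁ k0<k' = earlier rest k' k0<k' k'<k
      ... | inj₂ refl  = d

    -- The column chosen at step j (0 when no column is added).
    chosen : Mat → ℕ → ℕ
    chosen X j = if rowZero n X j then min1 G j
                 else (if findK n X j j 1 <ᵇ j then min2 G j (findK n X j j 1) else 0)

    data Step (j : ℕ) (C : List ℕ) : ℕ → Set where
      skip : Identifies (suc j) C → Step j C 0
      add  : ∀ {l} → 1 ≤ l → l ≤ m → Identifies (suc j) (C ++ [ l ]) → Step j C l

    extend : ∀ {j C} → Identifies j C → Dom C j → (∀ i' → 1 ≤ i' → i' < j → Sep C j i') →
      Identifies (suc j) C
    extend {j} {C} ids dom sep = record { dominated = dominated′ ; separated = separated′ }
      where
      dominated′ : ∀ i → 1 ≤ i → i < suc j → Dom C i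
      dominated′ i 1≤i (s≤s i≤j) with ℕ.m≤n⇒m<n∨m≡n i≤j
      ... | inj₁ i<j = dominated ids i 1≤i i<j
      ... | inj₂ refl = dom
      separated′ : ∀ i i' → 1 ≤ i' → i' < i → i < suc j → Sep C i i'
      separated′ i i' 1≤i' i'<i (s≤s i≤j) with ℕ.m≤n⇒m<n∨m≡n i≤j
      ... | inj₁ i<j = separated ids i i' 1≤i' i'<i i<j
      ... | inj₂ refl = sep i' 1≤i' i'<i

    add-column : ∀ {j C l} → Identifies j C → l ∈ range m →
      Dom (C ++ [ l ]) j → (∀ i' → 1 ≤ i' → i' < j → Sep (C ++ [ l ]) j i') → Step j C l
    add-column {C = C} ids l∈ dom sep =
      add (proj₁ (range-bounds l∈)) (proj₂ (range-bounds l∈))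
        (extend (identifies-⊆ (xs⊆xs++ys C _) ids) dom sep)

    -- Row j is undominated: min1(j) dominates it, and every earlier row is
    -- dominated by C, where row j vanishes.
    step-undominated : ∀ {j C X} → Invariant C X → Identifies j C → 1 ≤ j → j ≤ n →
      rowZero n X j ≡ true → Step j C (min1 G j)
    step-undominated {j} {C} inv ids 1≤j j≤n z with min1-in-M 1≤j j≤n
    ... | l∈ , hit = add-column ids l∈ (min1 G j , ∈-++⁺ʳ C (here refl) , hit) sep
      where
      sep : ∀ i' → 1 ≤ i' → i' < j → Sep (C ++ [ min1 G j ]) j i'
      sep i' 1≤i' i'<j with dominated ids i' 1≤i' i'<j
      ... | l , l∈C , b = l , ∈-++⁺ˡ l∈C ,
            λ e → clash (undominated inv z l l∈C) (trans e b)

    -- Row j agrees on C with the earlier row k: min2(j,k) separates j from k,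
    -- earlier rows differ from j on C, and later rows i' are separated from k,
    -- hence from j.
    step-twin : ∀ {j C X k} → Invariant C X → Identifies j C → 1 ≤ j → j ≤ n →
      rowZero n X j ≡ false → FirstTwin X j 1 k → k < j → Step j C (min2 G j k)
    step-twin {j} {C} {X} {k} inv ids 1≤j j≤n nz ft k<j
      with min2-in-M 1≤j j≤n (start ft) (ℕ.≤-trans (stop ft) j≤n) (λ j≡k → ℕ.<-irrefl (≡.sym j≡k) k<j)
    ... | l∈ , separating = add-column ids l∈ dom sep
      where
      C' : List ℕ
      C' = C ++ [ min2 G j k ]
      dom : Dom C' j
      dom = let (l , l∈C , b) = dominated-row inv nz in l , ∈-++⁺ˡ l∈C , b
      sep : ∀ i' → 1 ≤ i' → i' < j → Sep C' j i'
      sep i' 1≤i' i'<j with ℕ.<-cmp i' k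
      ... | tri< i'<k _ _ = let (l , l∈C , ne) = separated-rows inv (earlier ft i' 1≤i' i'<k) in
                            l , ∈-++⁺ˡ l∈C , ne
      ... | tri≈ _ refl _ = min2 G j k , ∈-++⁺ʳ C (here refl) , separating
      ... | tri> _ _ k<i' = let (l , l∈C , ne) = separated ids i' k (start ft) k<i' i'<j in
                            l , ∈-++⁺ˡ l∈C ,
                            λ e → ne (trans (≡.sym e) (twin-rows inv (twin ft k<j) l l∈C))

    step-identified : ∀ {j C X k} → Invariant C X → Identifies j C →
      rowZero n X j ≡ false → FirstTwin X j 1 k → j ≤ k → Step j C 0
    step-identified inv ids nz ft j≤k =
      skip (extend ids (dominated-row inv nz)
        λ i' 1≤i' i'<j → separated-rows inv (earlier ft i' 1≤i' (ℕ.<-≤-trans i'<j j≤k)))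

    step : ∀ {j C X} → Invariant C X → Identifies j C → 1 ≤ j → j ≤ n → Step j C (chosen X j)
    step {j} {C} {X} inv ids 1≤j j≤n with rowZero n X j in z | findK n X j j 1 <ᵇ j in lt
    ... | true  | _     = step-undominated inv ids 1≤j j≤n z
    ... | false | true  = step-twin inv ids 1≤j j≤n z (findK-spec X j j 1 1≤j (ℕ.n≤1+n j))
                            (<ᵇ-true lt)
    ... | false | false = step-identified inv ids z (findK-spec X j j 1 1≤j (ℕ.n≤1+n j))
                            (<ᵇ-false lt)

    Result : List ℕ → Set
    Result L = Bounded m L × Identifies (suc n) L

    identifies-init : Identifies 1 []
    identifies-init = record
      { dominated = λ { i (s≤s z≤n) (s≤s ()) }
      ; separated = λ { i i' (s≤s z≤n) (s≤s i'<i) (s≤s ()) } }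

    loop : ∀ f j C X → j + f ≡ suc n → 1 ≤ j → Invariant C X → Identifies j C →
      Result (lexLoop G f j C X)
    loop zero j C X j+0≡1+n _ inv ids =
      bounded inv , subst (λ i → Identifies i C) (trans (≡.sym (ℕ.+-identityʳ j)) j+0≡1+n) ids
    loop (suc f) j C X j+1+f≡1+n 1≤j inv ids =
      subst Result (≡.sym running) (continue (chosen X j) (step inv ids 1≤j j≤n))
      where
      next : suc j + f ≡ suc n
      next = trans (≡.sym (ℕ.+-suc j f)) j+1+f≡1+n
      j≤n : j ≤ n
      j≤n = ℕ.≤-trans (ℕ.m≤m+n j f) (ℕ.≤-reflexive (ℕ.suc-injective next))
      body : ℕ → List ℕ
      body l = if 1 ≤ᵇ l then lexLoop G f (suc j) (C ++ [ l ]) (if l ≤ᵇ n then setCol G X l else X)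
               else lexLoop G f (suc j) C X
      -- the guard holds: j ≤ n, and the sentinel n+1 is not in C
      running : lexLoop G (suc f) j C X ≡ body (chosen X j)
      running = if-true (cong₂ _∧_ (≤ᵇ-complete j≤n) (cong not (memb-absent below)))
        where
        below : ∀ c → c ∈ C → c < suc n
        below c c∈ = s≤s (ℕ.≤-trans (proj₂ (bounded inv c c∈)) m≤n)
      continue : ∀ l → Step j C l → Result (body l)
      continue .0 (skip ids′) = loop f (suc j) C X next (s≤s z≤n) inv ids′
      continue (suc l) (add (s≤s z≤n) l<m ids′) =
        subst (λ Y → Result (lexLoop G f (suc j) (C ++ [ suc l ]) Y))
          (≡.sym (if-true (≤ᵇ-complete (ℕ.≤-trans l<m m≤n))))
          (loop f (suc j) (C ++ [ suc l ]) (setCol G X (suc l)) next (s≤s z≤n)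
            (invariant-add inv (s≤s z≤n) l<m) ids′)

    lexAlg-correct : Result (lexAlg G)
    lexAlg-correct = loop n 1 [] (λ _ _ → false) refl (s≤s z≤n) invariant-init identifies-init

proposition2 : ∀ {n} (G : Graph n) → TwinFree G → (m : ℕ) → 1 ≤ m → m ≤ n →
    IsIdCode G (λ v → toℕ v < m) →
    (∀ c → c ∈ lexAlg G → 1 ≤ c × c ≤ m) × IsIdCode G (λ v → suc (toℕ v) ∈ lexAlg G)
proposition2 {n} G _ m _ m≤n M-code = within-M , code-from-identifies G within-vertices identified
  where
  M-identifies : Identifies G (suc n) (range m)
  M-identifies = identifies-from-code G (λ u u<m → ∈-range (s≤s z≤n) u<m) M-code
  open Algorithm G m m≤n M-identifies using (lexAlg-correct)
  within-M : Bounded m (lexAlg G)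
  within-M = proj₁ lexAlg-correct
  identified : Identifies G (suc n) (lexAlg G)
  identified = proj₂ lexAlg-correct
  within-vertices : Bounded n (lexAlg G)
  within-vertices c c∈ = map₂ (λ c≤m → ℕ.≤-trans c≤m m≤n) (within-M c c∈)
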